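{- Let $n,\ell,u$ be nonnegative integers with $n\ge \ell+u$, let $p\in(0,1)$, $q=1-p$. Fix $L\subseteq\{0,\dots,\ell-1\}$ and $U\subseteq\{n-u,\dots,n-1\}$. Let $R$ be a random subset of $\{\ell,\dots,n-u-1\}$, each element included independently with probability $p$, and set $A=L\cup R\cup U$. Then $$\mathbb{P}\Bigl(\{2\ell-1,\dots,n-u-1\}\cup\{n+\ell-1,\dots,2n-2u-1\}\subseteq A+A\Bigr)>1-\frac{1+q}{p^2}\bigl(q^{|L|}+q^{|U|}\bigr).$$
   Context: $A+A=\{a+a':a,a'\in A\}$. -}

module Defs where

open import Level using (Level; suc; _⊔_)
open import Data.Nat as ℕ using (ℕ; zero; _∸_; _≡ᵇ_)
open import Data.Bool using (Bool; true; false; _∧_; _∨_; if_then_else_)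
open import Data.Fin using (Fin; toℕ)
open import Data.Fin.Subset using (Subset; _∈_; ∣_∣)
open import Data.Vec using (Vec; []; _∷_; lookup)
open import Data.List using (List; []; _∷_; _++_; map; upTo; allFin; concatMap)
open import Data.Bool.ListAction using (any; all)
open import Relation.Binary.Core using (Rel)
open import Relation.Binary.Structures using (IsStrictTotalOrder)
open import Relation.Nullary using (¬_)
open import Algebra.Bundles using (CommutativeRing)

-- Ordered fields (the standard library has none).  The statement is
-- made for an arbitrary ordered field, in particular for ℝ.

record OrderedField (c ℓ₁ ℓ₂ : Level) : Set (suc (c ⊔ ℓ₁ ⊔ ℓ₂)) where
  field
    commutativeRing : CommutativeRing c ℓ₁
  open CommutativeRing commutativeRing public
  field
    _<_                : Rel Carrier ℓ₂
    isStrictTotalOrder : IsStrictTotalOrder _≈_ _<_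
    0<1                : 0# < 1#
    +-monoˡ-<          : ∀ {x y} z → x < y → (x + z) < (y + z)
    *-pos              : ∀ {x y} → 0# < x → 0# < y → 0# < (x * y)
    _⁻¹                : Carrier → Carrier
    ⁻¹-inverse         : ∀ x → ¬ (x ≈ 0#) → (x * (x ⁻¹)) ≈ 1#

  infixr 8 _^_
  _^_ : Carrier → ℕ → Carrier
  x ^ zero    = 1#
  x ^ ℕ.suc k = x * (x ^ k)

  Σ-list : {A : Set} → List A → (A → Carrier) → Carrier
  Σ-list []       f = 0#
  Σ-list (a ∷ as) f = f a + Σ-list as f

  Π-list : {A : Set} → List A → (A → Carrier) → Carrier
  Π-list []       f = 1#
  Π-list (a ∷ as) f = f a * Π-list as f

  indicator : Bool → Carrier
  indicator true  = 1#
  indicator false = 0#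

-- Subsets of {0,…,n-1} are 'Subset n' (= Vec Bool n); element i ↔ toℕ i.

allSubsets : (n : ℕ) → List (Subset n)
allSubsets zero      = [] ∷ []
allSubsets (ℕ.suc n) = concatMap (λ s → (false ∷ s) ∷ (true ∷ s) ∷ []) (allSubsets n)

_∪ₛ_ : ∀ {n} → Subset n → Subset n → Subset n
[] ∪ₛ [] = []
(x ∷ xs) ∪ₛ (y ∷ ys) = (x ∨ y) ∷ (xs ∪ₛ ys)

-- the natural numbers a, a+1, …, b  (empty if b < a)
interval : ℕ → ℕ → List ℕ
interval a b = map (a ℕ.+_) (upTo (ℕ.suc b ∸ a))

-- t ∈ A + A, where t is an integer given as s = t + 1 ∈ ℕ
-- (so that the integer t = -1 is represented by s = 0)
inSumsetShift : ∀ {n} → Subset n → ℕ → Bool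
inSumsetShift {n} A s =
  any (λ i → any (λ j → lookup A i ∧ lookup A j ∧ (ℕ.suc (toℕ i ℕ.+ toℕ j) ≡ᵇ s)) (allFin n)) (allFin n)

-- the event  {2ℓ-1,…,n-u-1} ∪ {n+ℓ-1,…,2n-2u-1} ⊆ A + A   (ranges of integers t,
-- encoded via s = t+1: s ∈ [2ℓ, n-u] ∪ [n+ℓ, 2n-2u])
coveredEvent : (n ℓ u : ℕ) → Subset n → Bool
coveredEvent n ℓ u A =
  all (inSumsetShift A) (interval (2 ℕ.* ℓ) (n ∸ u) ++ interval (n ℕ.+ ℓ) (2 ℕ.* n ∸ 2 ℕ.* u))

isMiddle : ∀ {n} (ℓ u : ℕ) → Fin n → Bool
isMiddle {n} ℓ u i = (ℓ ℕ.≤ᵇ toℕ i) ∧ (ℕ.suc (toℕ i) ℕ.≤ᵇ n ∸ u)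

module _ {c ℓ₁ ℓ₂} (F : OrderedField c ℓ₁ ℓ₂) where
  open OrderedField F

  -- probability that the random set R equals the given subset of Fin n,
  -- where R ⊆ {ℓ,…,n-u-1} contains each element independently w.p. p
  weight : (p : Carrier) (n ℓ u : ℕ) → Subset n → Carrier
  weight p n ℓ u R = Π-list (allFin n) λ i →
    if isMiddle ℓ u i
      then (if lookup R i then p else (1# - p))
      else (if lookup R i then 0# else 1#)

  probCovered : (p : Carrier) (n ℓ u : ℕ) → Subset n → Subset n → Carrier
  probCovered p n ℓ u L U = Σ-list (allSubsets n) λ R →
    weight p n ℓ u R * indicator (coveredEvent n ℓ u ((L ∪ₛ R) ∪ₛ U))

-- By the union bound, the failure probability is at most the sum over
-- the targets t of P(t ∉ A + A).  The positions of a target t split into the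
-- disjoint pairs {x, t - x}, so the events "this pair is not inside A" are
-- independent and P(t ∉ A + A) is at most the product of their probabilities.
-- For a lower target t = 2ℓ-1+i each y < ℓ is paired with a middle position
-- (factor q if y ∈ L, 1 otherwise) and the i middle positions between them
-- contribute noPairs i = r^⌊i/2⌋ q^(i mod 2), where r = 1 - p²; upper targets
-- are symmetric, with U in place of L.  Finally every partial sum of the
-- series Σ noPairs i is below D = (1+q)/p², the fixed point of D = 1 + q + rD.

module Submission where

open import Defs
open import Level using (Level; _⊔_)
open import Data.Nat using (ℕ; _≤_; _∸_) renaming (_+_ to _+ℕ_; _<_ to _<ℕ_)
open import Data.Fin using (toℕ)
open import Data.Fin.Subset using (Subset; _∈_; ∣_∣)

open import Algebra.Bundles using (CommutativeMonoid)
open import Data.Bool using (Bool; true; false; _∧_; _∨_; T; if_then_else_)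
open import Data.Bool.ListAction using (all)
open import Data.Bool.Properties using (T-≡; ∨-identityʳ; ∧-zeroʳ)
open import Data.Empty using (⊥-elim)
open import Data.Fin using (Fin)
open import Data.List using (List; []; _∷_; _++_; map; applyUpTo; allFin; tabulate; concatMap)
open import Data.List.Membership.Propositional.Properties using (∈-allFin)
import Data.List.Relation.Unary.Any as Any
open import Data.List.Relation.Unary.Any.Properties using (any⁺)
open import Data.Nat using (zero; suc; z≤n; s≤s; _≡ᵇ_; _≤ᵇ_; _≟_) renaming (_*_ to _*ℕ_)
import Data.Nat.Properties as NP
open import Data.Nat.Tactic.RingSolver using (solve-∀)
open import Data.Product using (Σ; _×_; _,_)
open import Data.Sum as Sum using (_⊎_; inj₁; inj₂; swap)
open import Data.Vec using (_∷_; []; lookup; here; there)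
open import Data.Vec.Properties using ([]=⇒lookup)
open import Function using (case_of_)
open import Function.Bundles using (Equivalence)
open import Relation.Binary.Bundles using (StrictPartialOrder)
open import Relation.Binary.Definitions using (tri<; tri≈; tri>)
open import Relation.Binary.PropositionalEquality as ≡ using (_≡_; _≢_)
import Relation.Binary.Reasoning.StrictPartialOrder
open import Relation.Binary.Structures using (IsStrictTotalOrder)
open import Relation.Nullary using (¬_; yes; no)

module OrderedFieldProperties {c ℓ₁ ℓ₂ : Level} (F : OrderedField c ℓ₁ ℓ₂) where
  open OrderedField F public hiding (_<_)

  infix 4 _<_
  _<_ : Carrier → Carrier → Set ℓ₂
  _<_ = OrderedField._<_ F

  open IsStrictTotalOrder isStrictTotalOrder
    using (isStrictPartialOrder; compare; asym) renaming (irrefl to <-irrefl)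
  open import Algebra.Properties.Ring ring using (-‿distribʳ-*)

  strictPartialOrder : StrictPartialOrder c ℓ₁ ℓ₂
  strictPartialOrder = record { isStrictPartialOrder = isStrictPartialOrder }

  open import Relation.Binary.Construct.StrictToNonStrict _≈_ _<_ public
    using (<⇒≤) renaming (_≤_ to infix 4 _≤ᶠ_)
  module ≤-Reasoning = Relation.Binary.Reasoning.StrictPartialOrder strictPartialOrder
  open ≤-Reasoning

  +-monoʳ-< : ∀ z {x y} → x < y → z + x < z + y
  +-monoʳ-< z {x} {y} x<y = begin-strict
    z + x ≈⟨ +-comm z x ⟩
    x + z <⟨ +-monoˡ-< z x<y ⟩
    y + z ≈⟨ +-comm y z ⟩
    z + y ∎

  +-monoˡ-≤ : ∀ z {x y} → x ≤ᶠ y → x + z ≤ᶠ y + z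
  +-monoˡ-≤ z (inj₁ x<y) = inj₁ (+-monoˡ-< z x<y)
  +-monoˡ-≤ z (inj₂ x≈y) = inj₂ (+-cong x≈y refl)

  +-monoʳ-≤ : ∀ z {x y} → x ≤ᶠ y → z + x ≤ᶠ z + y
  +-monoʳ-≤ z (inj₁ x<y) = inj₁ (+-monoʳ-< z x<y)
  +-monoʳ-≤ z (inj₂ x≈y) = inj₂ (+-cong refl x≈y)

  +-mono-≤ : ∀ {a b x y} → a ≤ᶠ b → x ≤ᶠ y → a + x ≤ᶠ b + y
  +-mono-≤ {a} {b} {x} {y} a≤b x≤y = begin
    a + x ≤⟨ +-monoˡ-≤ x a≤b ⟩
    b + x ≤⟨ +-monoʳ-≤ b x≤y ⟩
    b + y ∎

  +-mono-< : ∀ {a b x y} → a < b → x < y → a + x < b + y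
  +-mono-< {a} {b} {x} {y} a<b x<y = begin-strict
    a + x <⟨ +-monoˡ-< x a<b ⟩
    b + x <⟨ +-monoʳ-< b x<y ⟩
    b + y ∎

  <⇒0<- : ∀ {x y} → x < y → 0# < y - x
  <⇒0<- {x} {y} x<y = begin-strict
    0#    ≈⟨ -‿inverseʳ x ⟨
    x - x <⟨ +-monoˡ-< (- x) x<y ⟩
    y - x ∎

  -‿+-cancel : ∀ x y → (y - x) + x ≈ y
  -‿+-cancel x y = begin-equality
    (y - x) + x   ≈⟨ +-assoc y (- x) x ⟩
    y + (- x + x) ≈⟨ +-cong refl (-‿inverseˡ x) ⟩
    y + 0#        ≈⟨ +-identityʳ y ⟩
    y             ∎

  0<-⇒< : ∀ {x y} → 0# < y - x → x < y
  0<-⇒< {x} {y} 0<y-x = begin-strict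
    x            ≈⟨ +-identityˡ x ⟨
    0# + x       <⟨ +-monoˡ-< x 0<y-x ⟩
    (y - x) + x  ≈⟨ -‿+-cancel x y ⟩
    y ∎

  1-‿swap-< : ∀ {x y} → 1# - x < y → 1# - y < x
  1-‿swap-< {x} {y} 1-x<y = begin-strict
    1# - y                ≈⟨ +-cong (-‿+-cancel x 1#) refl ⟨
    ((1# - x) + x) - y    ≈⟨ +-assoc (1# - x) x (- y) ⟩
    (1# - x) + (x - y)    <⟨ +-monoˡ-< (x - y) 1-x<y ⟩
    y + (x - y)           ≈⟨ +-comm y (x - y) ⟩
    (x - y) + y           ≈⟨ -‿+-cancel y x ⟩
    x                     ∎

  *-monoˡ-< : ∀ {z x y} → 0# < z → x < y → z * x < z * y
  *-monoˡ-< {z} {x} {y} 0<z x<y = 0<-⇒< (begin-strict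
    0#                <⟨ *-pos 0<z (<⇒0<- x<y) ⟩
    z * (y - x)       ≈⟨ distribˡ z y (- x) ⟩
    z * y + z * (- x) ≈⟨ +-cong refl (-‿distribʳ-* z x) ⟨
    z * y - z * x     ∎)

  *-monoˡ-≤ : ∀ {z x y} → 0# ≤ᶠ z → x ≤ᶠ y → z * x ≤ᶠ z * y
  *-monoˡ-≤ (inj₁ 0<z) (inj₁ x<y) = inj₁ (*-monoˡ-< 0<z x<y)
  *-monoˡ-≤ (inj₁ 0<z) (inj₂ x≈y) = inj₂ (*-cong refl x≈y)
  *-monoˡ-≤ {z} {x} {y} (inj₂ 0≈z) _ = inj₂ (begin-equality
    z * x  ≈⟨ *-cong (sym 0≈z) refl ⟩
    0# * x ≈⟨ zeroˡ x ⟩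
    0#     ≈⟨ zeroˡ y ⟨
    0# * y ≈⟨ *-cong 0≈z refl ⟩
    z * y  ∎)

  *-nonneg : ∀ {x y} → 0# ≤ᶠ x → 0# ≤ᶠ y → 0# ≤ᶠ x * y
  *-nonneg {x} {y} 0≤x 0≤y = begin
    0#     ≈⟨ zeroʳ x ⟨
    x * 0# ≤⟨ *-monoˡ-≤ 0≤x 0≤y ⟩
    x * y  ∎

  ^-pos : ∀ {x} → 0# < x → ∀ k → 0# < x ^ k
  ^-pos 0<x zero    = 0<1
  ^-pos 0<x (suc k) = *-pos 0<x (^-pos 0<x k)

  x⁻¹-inverse : ∀ {x} → 0# < x → x * (x ⁻¹) ≈ 1#
  x⁻¹-inverse 0<x = ⁻¹-inverse _ (λ x≈0 → <-irrefl (sym x≈0) 0<x)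

  x⁻¹-pos : ∀ {x} → 0# < x → 0# < (x ⁻¹)
  x⁻¹-pos {x} 0<x with compare 0# (x ⁻¹)
  ... | tri< 0<x⁻¹ _ _ = 0<x⁻¹
  ... | tri≈ _ 0≈x⁻¹ _ = ⊥-elim (<-irrefl (sym (begin-equality
    1#         ≈⟨ x⁻¹-inverse 0<x ⟨
    x * (x ⁻¹) ≈⟨ *-cong refl 0≈x⁻¹ ⟨
    x * 0#     ≈⟨ zeroʳ x ⟩
    0# ∎)) 0<1)
  ... | tri> _ _ x⁻¹<0 = ⊥-elim (asym 0<1 (begin-strict
    1#         ≈⟨ x⁻¹-inverse 0<x ⟨
    x * (x ⁻¹) <⟨ *-monoˡ-< 0<x x⁻¹<0 ⟩
    x * 0#     ≈⟨ zeroʳ x ⟩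
    0# ∎))

module RangeFold {a ℓ : Level} (M : CommutativeMonoid a ℓ) where
  open CommutativeMonoid M
  open import Relation.Binary.Reasoning.Setoid setoid

  fold : ℕ → (ℕ → Carrier) → Carrier
  fold zero    f = ε
  fold (suc m) f = f 0 ∙ fold m (λ i → f (suc i))

  fold-cong : ∀ m {f g : ℕ → Carrier} → (∀ i → i <ℕ m → f i ≈ g i) → fold m f ≈ fold m g
  fold-cong zero    f≈g = refl
  fold-cong (suc m) f≈g = ∙-cong (f≈g 0 (s≤s z≤n)) (fold-cong m (λ i i<m → f≈g (suc i) (s≤s i<m)))

  fold-ε : ∀ m (f : ℕ → Carrier) → (∀ i → i <ℕ m → f i ≈ ε) → fold m f ≈ ε
  fold-ε m f f≈ε = trans (fold-cong m f≈ε) (neutral m)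
    where
      neutral : ∀ m → fold m (λ _ → ε) ≈ ε
      neutral zero    = refl
      neutral (suc m) = trans (identityˡ _) (neutral m)

  fold-split : ∀ a b (f : ℕ → Carrier) → fold (a +ℕ b) f ≈ fold a f ∙ fold b (λ i → f (a +ℕ i))
  fold-split zero    b f = sym (identityˡ _)
  fold-split (suc a) b f = begin
    f 0 ∙ fold (a +ℕ b) (λ i → f (suc i))
      ≈⟨ ∙-cong refl (fold-split a b (λ i → f (suc i))) ⟩
    f 0 ∙ (fold a (λ i → f (suc i)) ∙ fold b (λ i → f (suc a +ℕ i)))
      ≈⟨ assoc _ _ _ ⟨
    fold (suc a) f ∙ fold b (λ i → f (suc a +ℕ i)) ∎

  fold-snoc : ∀ m (f : ℕ → Carrier) → fold (suc m) f ≈ fold m f ∙ f m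
  fold-snoc m f = begin
    fold (suc m) f                 ≡⟨ ≡.cong (λ k → fold k f) (NP.+-comm 1 m) ⟩
    fold (m +ℕ 1) f                ≈⟨ fold-split m 1 f ⟩
    fold m f ∙ (f (m +ℕ 0) ∙ ε)    ≈⟨ ∙-cong refl (identityʳ _) ⟩
    fold m f ∙ f (m +ℕ 0)          ≡⟨ ≡.cong (λ k → fold m f ∙ f k) (NP.+-identityʳ m) ⟩
    fold m f ∙ f m                 ∎

  fold-reverse : ∀ m (f : ℕ → Carrier) → fold m (λ i → f (m ∸ suc i)) ≈ fold m f
  fold-reverse zero    f = refl
  fold-reverse (suc m) f = begin
    f m ∙ fold m (λ i → f (m ∸ suc i)) ≈⟨ ∙-cong refl (fold-reverse m f) ⟩
    f m ∙ fold m f                     ≈⟨ comm _ _ ⟩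
    fold m f ∙ f m                     ≈⟨ fold-snoc m f ⟨
    fold (suc m) f                     ∎

+-suc² : ∀ m k → m +ℕ suc (suc k) ≡ suc (suc (m +ℕ k))
+-suc² m k = ≡.trans (NP.+-suc m (suc k)) (≡.cong suc (NP.+-suc m k))

interval-index : ∀ a b i → i <ℕ suc b ∸ a → a +ℕ i ≤ b
interval-index zero    b       i i<b+1   = NP.≤-pred i<b+1
interval-index (suc a) zero    i i<1-a   with () ← NP.≤-trans i<1-a (NP.≤-reflexive (NP.0∸n≡0 a))
interval-index (suc a) (suc b) i i<b+1-a = s≤s (interval-index a b i i<b+1-a)

-- Subsets of {0,…,n-1} read and written at natural-number positions:
-- get A x says whether x ∈ A (false for x ≥ n), and upd A x b sets the bit of x.
get : ∀ {n} → Subset n → ℕ → Bool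
get []      _       = false
get (a ∷ A) zero    = a
get (a ∷ A) (suc x) = get A x

upd : ∀ {n} → Subset n → ℕ → Bool → Subset n
upd []      _       _ = []
upd (a ∷ A) zero    b = b ∷ A
upd (a ∷ A) (suc x) b = a ∷ upd A x b

get-upd-≢ : ∀ {n} (A : Subset n) {x y} b → x ≢ y → get (upd A x b) y ≡ get A y
get-upd-≢ []      b x≢y = ≡.refl
get-upd-≢ (a ∷ A) {zero}  {zero}  b x≢y = ⊥-elim (x≢y ≡.refl)
get-upd-≢ (a ∷ A) {zero}  {suc y} b x≢y = ≡.refl
get-upd-≢ (a ∷ A) {suc x} {zero}  b x≢y = ≡.refl
get-upd-≢ (a ∷ A) {suc x} {suc y} b x≢y = get-upd-≢ A b (λ x≡y → x≢y (≡.cong suc x≡y))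

get-∪ : ∀ {n} (A B : Subset n) x → get (A ∪ₛ B) x ≡ get A x ∨ get B x
get-∪ []      []      x       = ≡.refl
get-∪ (a ∷ A) (b ∷ B) zero    = ≡.refl
get-∪ (a ∷ A) (b ∷ B) (suc x) = get-∪ A B x

get-beyond : ∀ {n} (A : Subset n) x → n ≤ x → get A x ≡ false
get-beyond []      x       _         = ≡.refl
get-beyond (a ∷ A) (suc x) (s≤s n≤x) = get-beyond A x n≤x

get-true : ∀ {n} (A : Subset n) x → get A x ≡ true → Σ (Fin n) λ i → toℕ i ≡ x × i ∈ A
get-true (true ∷ A) zero    _ = Fin.zero , ≡.refl , here
get-true (a ∷ A)    (suc x) e with get-true A x e
... | i , i≡x , i∈A = Fin.suc i , ≡.cong suc i≡x , there i∈A

get-outside : ∀ {n} (A : Subset n) (Q : ℕ → Set) → (∀ i → i ∈ A → Q (toℕ i)) →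
              ∀ x → ¬ Q x → get A x ≡ false
get-outside A Q A⊆Q x ¬Qx with get A x in e
... | false = ≡.refl
... | true with get-true A x e
...   | i , ≡.refl , i∈A = ⊥-elim (¬Qx (A⊆Q i i∈A))

≤ᵇ-true : ∀ {m k} → m ≤ k → (m ≤ᵇ k) ≡ true
≤ᵇ-true m≤k = Equivalence.to T-≡ (NP.≤⇒≤ᵇ m≤k)

≤ᵇ-false : ∀ {m k} → ¬ m ≤ k → (m ≤ᵇ k) ≡ false
≤ᵇ-false {m} {k} m≰k with m ≤ᵇ k in e
... | false = ≡.refl
... | true  = ⊥-elim (m≰k (NP.≤ᵇ⇒≤ m k (Equivalence.from T-≡ e)))

∧-idem-false : ∀ {b} → (b ∧ b) ≡ false → b ≡ false
∧-idem-false {false} _ = ≡.refl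

sumset-witness : ∀ {n} (A : Subset n) x z s →
  get A x ≡ true → get A z ≡ true → suc (x +ℕ z) ≡ s → T (inSumsetShift A s)
sumset-witness A x z s x∈A z∈A x+z≡t with get-true A x x∈A | get-true A z z∈A
... | i , ≡.refl , i∈A | j , ≡.refl , j∈A =
  any⁺ _ (Any.map (λ { ≡.refl → any⁺ _ (Any.map (λ { ≡.refl → witness }) (∈-allFin j)) }) (∈-allFin i))
  where
    witness : T (lookup A i ∧ lookup A j ∧ (suc (toℕ i +ℕ toℕ j) ≡ᵇ s))
    witness rewrite []=⇒lookup i∈A | []=⇒lookup j∈A = NP.≡⇒≡ᵇ _ _ x+z≡t

sumset-absent : ∀ {n} (A : Subset n) x z s →
  inSumsetShift A s ≡ false → suc (x +ℕ z) ≡ s → (get A x ∧ get A z) ≡ false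
sumset-absent A x z s t∉A+A x+z≡t with get A x in ex | get A z in ez
... | false | _     = ≡.refl
... | true  | false = ≡.refl
... | true  | true  with inSumsetShift A s | sumset-witness A x z s ex ez x+z≡t
...   | false | ()

module FiniteSums {c ℓ₁ ℓ₂ : Level} (F : OrderedField c ℓ₁ ℓ₂) where
  open OrderedFieldProperties F
  open import Algebra.Solver.Ring.NaturalCoefficients.Default commutativeSemiring
    using (solve; _:+_; _:=_)

  module Σᵣ = RangeFold +-commutativeMonoid

  Σ-list-cong : ∀ {A : Set} (xs : List A) {f g : A → Carrier} →
                (∀ x → f x ≈ g x) → Σ-list xs f ≈ Σ-list xs g
  Σ-list-cong []       f≈g = refl
  Σ-list-cong (x ∷ xs) f≈g = +-cong (f≈g x) (Σ-list-cong xs f≈g)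

  Σ-list-++ : ∀ {A : Set} (xs ys : List A) (f : A → Carrier) →
              Σ-list (xs ++ ys) f ≈ Σ-list xs f + Σ-list ys f
  Σ-list-++ []       ys f = sym (+-identityˡ _)
  Σ-list-++ (x ∷ xs) ys f = trans (+-cong refl (Σ-list-++ xs ys f)) (sym (+-assoc _ _ _))

  Σ-list-+ : ∀ {A : Set} (xs : List A) (f g : A → Carrier) →
             Σ-list xs (λ x → f x + g x) ≈ Σ-list xs f + Σ-list xs g
  Σ-list-+ []       f g = sym (+-identityʳ 0#)
  Σ-list-+ (x ∷ xs) f g = trans (+-cong refl (Σ-list-+ xs f g))
    (solve 4 (λ a b c d → (a :+ b :+ (c :+ d)) := ((a :+ c) :+ (b :+ d))) refl
      (f x) (g x) (Σ-list xs f) (Σ-list xs g))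

  Σ-list-scale : ∀ {A : Set} (xs : List A) z (f : A → Carrier) →
                 Σ-list xs (λ x → z * f x) ≈ z * Σ-list xs f
  Σ-list-scale []       z f = sym (zeroʳ z)
  Σ-list-scale (x ∷ xs) z f = trans (+-cong refl (Σ-list-scale xs z f)) (sym (distribˡ z _ _))

  Σᵣ-scale : ∀ m z (f : ℕ → Carrier) → Σᵣ.fold m (λ i → z * f i) ≈ z * Σᵣ.fold m f
  Σᵣ-scale zero    z f = sym (zeroʳ z)
  Σᵣ-scale (suc m) z f = trans (+-cong refl (Σᵣ-scale m z (λ i → f (suc i)))) (sym (distribˡ z _ _))

  Σᵣ-mono : ∀ m {f g : ℕ → Carrier} → (∀ i → i <ℕ m → f i ≤ᶠ g i) → Σᵣ.fold m f ≤ᶠ Σᵣ.fold m g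
  Σᵣ-mono zero    f≤g = inj₂ refl
  Σᵣ-mono (suc m) f≤g = +-mono-≤ (f≤g 0 (s≤s z≤n)) (Σᵣ-mono m (λ i i<m → f≤g (suc i) (s≤s i<m)))

  Σ-list-interval : ∀ a b (f : ℕ → Carrier) →
                    Σ-list (interval a b) f ≡ Σᵣ.fold (suc b ∸ a) (λ i → f (a +ℕ i))
  Σ-list-interval a b f = go (suc b ∸ a) (λ i → i)
    where
      go : ∀ m (h : ℕ → ℕ) → Σ-list (map (a +ℕ_) (applyUpTo h m)) f ≡ Σᵣ.fold m (λ i → f (a +ℕ h i))
      go zero    h = ≡.refl
      go (suc m) h = ≡.cong (f (a +ℕ h 0) +_) (go m (λ i → h (suc i)))

  Π-list-tabulate : ∀ n {A : Set} (h : Fin n → A) (g : A → Carrier) →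
                    Π-list (tabulate h) g ≡ Π-list (allFin n) (λ i → g (h i))
  Π-list-tabulate zero    h g = ≡.refl
  Π-list-tabulate (suc n) h g = ≡.cong (g (h Fin.zero) *_)
    (≡.trans (Π-list-tabulate n (λ i → h (Fin.suc i)) g)
             (≡.sym (Π-list-tabulate n Fin.suc (λ i → g (h i)))))

-- Expectation with respect to a product measure on Subset n: coordinate k is
-- an independent random bit taking the value b with probability ω k b.
module ProductMeasure {c ℓ₁ ℓ₂ : Level} (F : OrderedField c ℓ₁ ℓ₂) where
  open OrderedFieldProperties F
  open ≤-Reasoning
  open FiniteSums F
  open import Algebra.Solver.Ring.NaturalCoefficients.Default commutativeSemiring
    using (solve; _:+_; _:*_; _:=_)
  open import Algebra.Properties.Ring ring using (-1*x≈-x)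

  Weights : Set c
  Weights = ℕ → Bool → Carrier

  shift : Weights → Weights
  shift ω k = ω (suc k)

  E : (n : ℕ) → Weights → (Subset n → Carrier) → Carrier
  E zero    ω f = f []
  E (suc n) ω f = ω 0 false * E n (shift ω) (λ R → f (false ∷ R))
                + ω 0 true  * E n (shift ω) (λ R → f (true ∷ R))

  Normalised : Weights → Set ℓ₁
  Normalised ω = ∀ k → ω k false + ω k true ≈ 1#

  NonNegative : Weights → Set (ℓ₁ ⊔ ℓ₂)
  NonNegative ω = ∀ k b → 0# ≤ᶠ ω k b

  Ignores : ∀ {n} → ℕ → (Subset n → Carrier) → Set ℓ₁
  Ignores k f = ∀ R b → f (upd R k b) ≈ f R

  Ignores-* : ∀ {n} k {f g : Subset n → Carrier} → Ignores k f → Ignores k g → Ignores k (λ R → f R * g R)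
  Ignores-* k f-ignores g-ignores R b = *-cong (f-ignores R b) (g-ignores R b)

  Ignores-1- : ∀ {n} k {f : Subset n → Carrier} → Ignores k f → Ignores k (λ R → 1# - f R)
  Ignores-1- k f-ignores R b = +-cong refl (-‿cong (f-ignores R b))

  E-cong : ∀ n ω {f g : Subset n → Carrier} → (∀ R → f R ≈ g R) → E n ω f ≈ E n ω g
  E-cong zero    ω f≈g = f≈g []
  E-cong (suc n) ω f≈g = +-cong (*-cong refl (E-cong n (shift ω) (λ R → f≈g (false ∷ R))))
                                (*-cong refl (E-cong n (shift ω) (λ R → f≈g (true ∷ R))))

  E-ignore-first : ∀ n ω → Normalised ω → (f : Subset (suc n) → Carrier) →
                   (∀ R → f (true ∷ R) ≈ f (false ∷ R)) →
                   E (suc n) ω f ≈ E n (shift ω) (λ R → f (false ∷ R))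
  E-ignore-first n ω nm f f-ignores = begin-equality
    ω 0 false * E₀ + ω 0 true * E n (shift ω) (λ R → f (true ∷ R))
      ≈⟨ +-cong refl (*-cong refl (E-cong n (shift ω) f-ignores)) ⟩
    ω 0 false * E₀ + ω 0 true * E₀ ≈⟨ distribʳ E₀ _ _ ⟨
    (ω 0 false + ω 0 true) * E₀    ≈⟨ *-cong (nm 0) refl ⟩
    1# * E₀                        ≈⟨ *-identityˡ E₀ ⟩
    E₀                             ∎
    where
      E₀ : Carrier
      E₀ = E n (shift ω) (λ R → f (false ∷ R))

  E-const : ∀ n ω → Normalised ω → ∀ x → E n ω (λ _ → x) ≈ x
  E-const zero    ω nm x = refl
  E-const (suc n) ω nm x =
    trans (E-ignore-first n ω nm (λ _ → x) (λ _ → refl)) (E-const n (shift ω) (λ k → nm (suc k)) x)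

  E-+ : ∀ n ω (f g : Subset n → Carrier) → E n ω (λ R → f R + g R) ≈ E n ω f + E n ω g
  E-+ zero    ω f g = refl
  E-+ (suc n) ω f g = begin-equality
    a * E n ω' (λ R → f (false ∷ R) + g (false ∷ R)) + b * E n ω' (λ R → f (true ∷ R) + g (true ∷ R))
      ≈⟨ +-cong (*-cong refl (E-+ n ω' _ _)) (*-cong refl (E-+ n ω' _ _)) ⟩
    a * (F₀ + G₀) + b * (F₁ + G₁)
      ≈⟨ solve 6 (λ a b F₀ G₀ F₁ G₁ → (a :* (F₀ :+ G₀) :+ b :* (F₁ :+ G₁))
                                     := ((a :* F₀ :+ b :* F₁) :+ (a :* G₀ :+ b :* G₁))) refl a b F₀ G₀ F₁ G₁ ⟩
    (a * F₀ + b * F₁) + (a * G₀ + b * G₁) ∎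
    where
      ω' : Weights
      ω' = shift ω
      a b F₀ F₁ G₀ G₁ : Carrier
      a  = ω 0 false
      b  = ω 0 true
      F₀ = E n ω' (λ R → f (false ∷ R))
      F₁ = E n ω' (λ R → f (true ∷ R))
      G₀ = E n ω' (λ R → g (false ∷ R))
      G₁ = E n ω' (λ R → g (true ∷ R))

  E-mono : ∀ n ω → NonNegative ω → {f g : Subset n → Carrier} →
           (∀ R → f R ≤ᶠ g R) → E n ω f ≤ᶠ E n ω g
  E-mono zero    ω nn f≤g = f≤g []
  E-mono (suc n) ω nn f≤g =
    +-mono-≤ (*-monoˡ-≤ (nn 0 false) (E-mono n (shift ω) (λ k → nn (suc k)) (λ R → f≤g (false ∷ R))))
             (*-monoˡ-≤ (nn 0 true)  (E-mono n (shift ω) (λ k → nn (suc k)) (λ R → f≤g (true ∷ R))))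

  E-factor : ∀ n ω → Normalised ω → (f g : Subset n → Carrier) →
             (∀ k → Ignores k f ⊎ Ignores k g) →
             E n ω (λ R → f R * g R) ≈ E n ω f * E n ω g
  E-factor zero    ω nm f g disjoint = refl
  E-factor (suc n) ω nm f g disjoint = case disjoint 0 of λ where
      (inj₁ f-ignores-0) → first-ignored f g disjoint f-ignores-0
      (inj₂ g-ignores-0) → begin-equality
        E (suc n) ω (λ R → f R * g R) ≈⟨ E-cong (suc n) ω (λ R → *-comm (f R) (g R)) ⟩
        E (suc n) ω (λ R → g R * f R) ≈⟨ first-ignored g f (λ k → swap (disjoint k)) g-ignores-0 ⟩
        E (suc n) ω g * E (suc n) ω f ≈⟨ *-comm _ _ ⟩
        E (suc n) ω f * E (suc n) ω g ∎
    where
      ω' : Weights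
      ω' = shift ω
      a b : Carrier
      a  = ω 0 false
      b  = ω 0 true
      nm' : Normalised ω'
      nm' k = nm (suc k)

      first-ignored : ∀ f g → (∀ k → Ignores k f ⊎ Ignores k g) → Ignores 0 f →
                      E (suc n) ω (λ R → f R * g R) ≈ E (suc n) ω f * E (suc n) ω g
      first-ignored f g disjoint f-ignores-0 = begin-equality
        a * E n ω' (λ R → f (false ∷ R) * g₀ R) + b * E n ω' (λ R → f (true ∷ R) * g₁ R)
          ≈⟨ +-cong refl (*-cong refl (E-cong n ω' (λ R → *-cong (f-ignores-0 (false ∷ R) true) refl))) ⟩
        a * E n ω' (λ R → f₀ R * g₀ R) + b * E n ω' (λ R → f₀ R * g₁ R)
          ≈⟨ +-cong (*-cong refl (E-factor n ω' nm' f₀ g₀ (restrict false)))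
                    (*-cong refl (E-factor n ω' nm' f₀ g₁ (restrict true))) ⟩
        a * (F₀ * G₀) + b * (F₀ * G₁)
          ≈⟨ solve 5 (λ a b F₀ G₀ G₁ → (a :* (F₀ :* G₀) :+ b :* (F₀ :* G₁))
                                       := (F₀ :* (a :* G₀ :+ b :* G₁))) refl a b F₀ G₀ G₁ ⟩
        F₀ * E (suc n) ω g
          ≈⟨ *-cong (E-ignore-first n ω nm f (λ R → f-ignores-0 (false ∷ R) true)) refl ⟨
        E (suc n) ω f * E (suc n) ω g ∎
        where
          f₀ g₀ g₁ : Subset n → Carrier
          f₀ R = f (false ∷ R)
          g₀ R = g (false ∷ R)
          g₁ R = g (true ∷ R)
          F₀ G₀ G₁ : Carrier
          F₀ = E n ω' f₀
          G₀ = E n ω' g₀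
          G₁ = E n ω' g₁
          restrict : ∀ v k → Ignores k f₀ ⊎ Ignores k (λ R → g (v ∷ R))
          restrict v k with disjoint (suc k)
          ... | inj₁ f-ignores = inj₁ (λ R → f-ignores (false ∷ R))
          ... | inj₂ g-ignores = inj₂ (λ R → g-ignores (v ∷ R))

  E-scale : ∀ n ω → Normalised ω → ∀ z (f : Subset n → Carrier) → E n ω (λ R → z * f R) ≈ z * E n ω f
  E-scale n ω nm z f = trans (E-factor n ω nm (λ _ → z) f (λ k → inj₁ (λ R b → refl)))
                             (*-cong (E-const n ω nm z) refl)

  E-complement : ∀ n ω → Normalised ω → (f : Subset n → Carrier) → E n ω (λ R → 1# - f R) ≈ 1# - E n ω f
  E-complement n ω nm f = begin-equality
    E n ω (λ R → 1# - f R)                       ≈⟨ E-+ n ω (λ _ → 1#) (λ R → - f R) ⟩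
    E n ω (λ _ → 1#) + E n ω (λ R → - f R)
      ≈⟨ +-cong (E-const n ω nm 1#) (E-cong n ω (λ R → sym (-1*x≈-x (f R)))) ⟩
    1# + E n ω (λ R → - 1# * f R)                ≈⟨ +-cong refl (E-scale n ω nm (- 1#) f) ⟩
    1# + - 1# * E n ω f                          ≈⟨ +-cong refl (-1*x≈-x _) ⟩
    1# - E n ω f                                 ∎

  E-Σ-list : ∀ n ω → Normalised ω → ∀ {A : Set} (xs : List A) (g : A → Subset n → Carrier) →
             E n ω (λ R → Σ-list xs (λ s → g s R)) ≈ Σ-list xs (λ s → E n ω (g s))
  E-Σ-list n ω nm []       g = E-const n ω nm 0#
  E-Σ-list n ω nm (x ∷ xs) g = trans (E-+ n ω (g x) (λ R → Σ-list xs (λ s → g s R)))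
                                     (+-cong refl (E-Σ-list n ω nm xs g))

  E-coordinate : ∀ n ω → Normalised ω → ∀ x → x <ℕ n → (h : Bool → Carrier) →
                 E n ω (λ R → h (get R x)) ≈ ω x false * h false + ω x true * h true
  E-coordinate (suc n) ω nm zero    _ h =
    +-cong (*-cong refl (E-const n (shift ω) nm' (h false))) (*-cong refl (E-const n (shift ω) nm' (h true)))
    where
      nm' : Normalised (shift ω)
      nm' k = nm (suc k)
  E-coordinate (suc n) ω nm (suc x) (s≤s x<n) h =
    trans (E-ignore-first n ω nm (λ R → h (get R (suc x))) (λ R → refl))
          (E-coordinate n (shift ω) (λ k → nm (suc k)) x x<n h)

  E-as-sum : ∀ n ω (f : Subset n → Carrier) →
             Σ-list (allSubsets n) (λ R → Π-list (allFin n) (λ i → ω (toℕ i) (lookup R i)) * f R) ≈ E n ω f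
  E-as-sum zero    ω f = trans (+-identityʳ _) (*-identityˡ _)
  E-as-sum (suc n) ω f = begin-equality
    Σ-list (allSubsets (suc n)) (λ R → law R * f R)
      ≈⟨ Σ-list-pairs (allSubsets n) (λ R → law R * f R) ⟩
    Σ-list (allSubsets n) (λ R → law (false ∷ R) * f (false ∷ R) + law (true ∷ R) * f (true ∷ R))
      ≈⟨ Σ-list-cong (allSubsets n) (λ R → +-cong (unfold false R) (unfold true R)) ⟩
    Σ-list (allSubsets n) (λ R → ω 0 false * (law' R * f (false ∷ R)) + ω 0 true * (law' R * f (true ∷ R)))
      ≈⟨ Σ-list-+ (allSubsets n) _ _ ⟩
    Σ-list (allSubsets n) (λ R → ω 0 false * (law' R * f (false ∷ R)))
      + Σ-list (allSubsets n) (λ R → ω 0 true * (law' R * f (true ∷ R)))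
      ≈⟨ +-cong (Σ-list-scale (allSubsets n) _ _) (Σ-list-scale (allSubsets n) _ _) ⟩
    ω 0 false * Σ-list (allSubsets n) (λ R → law' R * f (false ∷ R))
      + ω 0 true * Σ-list (allSubsets n) (λ R → law' R * f (true ∷ R))
      ≈⟨ +-cong (*-cong refl (E-as-sum n (shift ω) _)) (*-cong refl (E-as-sum n (shift ω) _)) ⟩
    E (suc n) ω f ∎
    where
      law : Subset (suc n) → Carrier
      law R = Π-list (allFin (suc n)) (λ i → ω (toℕ i) (lookup R i))
      law' : Subset n → Carrier
      law' R = Π-list (allFin n) (λ i → shift ω (toℕ i) (lookup R i))
      unfold : ∀ v R → law (v ∷ R) * f (v ∷ R) ≈ ω 0 v * (law' R * f (v ∷ R))
      unfold v R = trans (*-cong (*-cong refl (reflexive (Π-list-tabulate n Fin.suc _))) refl) (*-assoc _ _ _)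
      Σ-list-pairs : (Rs : List (Subset n)) (g : Subset (suc n) → Carrier) →
        Σ-list (concatMap (λ R → (false ∷ R) ∷ (true ∷ R) ∷ []) Rs) g ≈ Σ-list Rs (λ R → g (false ∷ R) + g (true ∷ R))
      Σ-list-pairs []       g = refl
      Σ-list-pairs (R ∷ Rs) g = trans (sym (+-assoc _ _ _)) (+-cong refl (Σ-list-pairs Rs g))

module Indicators {c ℓ₁ ℓ₂ : Level} (F : OrderedField c ℓ₁ ℓ₂) where
  open OrderedFieldProperties F
  open ≤-Reasoning
  open import Algebra.Properties.Ring ring using (-0#≈0#)

  indicator-∧ : ∀ a b → indicator a * indicator b ≈ indicator (a ∧ b)
  indicator-∧ true  b = *-identityˡ _
  indicator-∧ false b = zeroˡ _

  1-indicator-false : 1# - indicator false ≈ 1#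
  1-indicator-false = trans (+-cong refl -0#≈0#) (+-identityʳ 1#)

  1-indicator-true : 1# - indicator true ≈ 0#
  1-indicator-true = -‿inverseʳ 1#

  0≤1 : 0# ≤ᶠ 1#
  0≤1 = <⇒≤ 0<1

  1-indicator-nonneg : ∀ b → 0# ≤ᶠ 1# - indicator b
  1-indicator-nonneg true  = inj₂ (sym 1-indicator-true)
  1-indicator-nonneg false = inj₁ (begin-strict 0# <⟨ 0<1 ⟩ 1# ≈⟨ 1-indicator-false ⟨ 1# - indicator false ∎)

  1-indicator²-nonneg : ∀ a b → 0# ≤ᶠ 1# - indicator a * indicator b
  1-indicator²-nonneg a b = begin
    0#                              ≤⟨ 1-indicator-nonneg (a ∧ b) ⟩
    1# - indicator (a ∧ b)          ≈⟨ +-cong refl (-‿cong (indicator-∧ a b)) ⟨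
    1# - indicator a * indicator b  ∎

  Σ-list-nonneg : ∀ {A : Set} (xs : List A) (f : A → Carrier) → (∀ x → 0# ≤ᶠ f x) → 0# ≤ᶠ Σ-list xs f
  Σ-list-nonneg []       f f≥0 = inj₂ refl
  Σ-list-nonneg (x ∷ xs) f f≥0 = begin
    0#                  ≈⟨ +-identityʳ 0# ⟨
    0# + 0#             ≤⟨ +-mono-≤ (f≥0 x) (Σ-list-nonneg xs f f≥0) ⟩
    f x + Σ-list xs f   ∎

  union-bound : ∀ {A : Set} (P : A → Bool) (xs : List A) →
                1# - indicator (all P xs) ≤ᶠ Σ-list xs (λ x → 1# - indicator (P x))
  union-bound P []       = inj₂ 1-indicator-true
  union-bound P (x ∷ xs) with P x
  ... | true  = begin
    1# - indicator (all P xs)                               ≤⟨ union-bound P xs ⟩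
    Σ-list xs (λ y → 1# - indicator (P y))                  ≈⟨ +-identityˡ _ ⟨
    0# + Σ-list xs (λ y → 1# - indicator (P y))             ≈⟨ +-cong 1-indicator-true refl ⟨
    (1# - indicator true) + Σ-list xs (λ y → 1# - indicator (P y)) ∎
  ... | false = begin
    1# - indicator false                                     ≈⟨ 1-indicator-false ⟩
    1#                                                       ≈⟨ +-identityʳ 1# ⟨
    1# + 0#
      ≤⟨ +-monoʳ-≤ 1# (Σ-list-nonneg xs _ (λ y → 1-indicator-nonneg (P y))) ⟩
    1# + Σ-list xs (λ y → 1# - indicator (P y))              ≈⟨ +-cong 1-indicator-false refl ⟨
    (1# - indicator false) + Σ-list xs (λ y → 1# - indicator (P y)) ∎

-- For the random set A = L ∪ R ∪ U, the variable
-- block lo k pairs the positions lo, …, lo+k-1 from the outside in,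
-- (lo, lo+k-1), (lo+1, lo+k-2), …, a middle position pairing with itself;
-- every pair sums to t = 2lo+k-1.  It is 1 when no pair lies inside A and
-- 0 otherwise, so it dominates the event  t ∉ A + A.
module Blocks {c ℓ₁ ℓ₂ : Level} (F : OrderedField c ℓ₁ ℓ₂) {n : ℕ} (L U : Subset n) where
  open OrderedFieldProperties F
  open ≤-Reasoning
  open ProductMeasure F using (Ignores; Ignores-*; Ignores-1-)
  open Indicators F

  A : Subset n → Subset n
  A R = (L ∪ₛ R) ∪ₛ U

  X : ℕ → Subset n → Carrier
  X x R = indicator (get (A R) x)

  get-A : ∀ R x → get (A R) x ≡ (get L x ∨ get R x) ∨ get U x
  get-A R x = ≡.trans (get-∪ (L ∪ₛ R) U x) (≡.cong (_∨ get U x) (get-∪ L R x))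

  X-ignores : ∀ {k x} → k ≢ x → Ignores k (X x)
  X-ignores {k} {x} k≢x R b = reflexive (≡.cong indicator (≡.trans (get-A (upd R k b) x)
    (≡.trans (≡.cong (λ v → (get L x ∨ v) ∨ get U x) (get-upd-≢ R b k≢x)) (≡.sym (get-A R x)))))

  block : ℕ → ℕ → Subset n → Carrier
  block lo zero          R = 1#
  block lo (suc zero)    R = 1# - X lo R
  block lo (suc (suc k)) R = (1# - X lo R * X (suc (lo +ℕ k)) R) * block (suc lo) k R

  outside-≢ : ∀ {c lo k} i → i <ℕ k → c <ℕ lo ⊎ lo +ℕ k ≤ c → c ≢ lo +ℕ i
  outside-≢ {lo = lo} i i<k (inj₁ c<lo)   ≡.refl = NP.<-irrefl ≡.refl (NP.<-≤-trans c<lo (NP.m≤m+n lo i))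
  outside-≢ {lo = lo} i i<k (inj₂ lo+k≤c) ≡.refl = NP.<-irrefl ≡.refl (NP.≤-<-trans (NP.+-cancelˡ-≤ lo _ _ lo+k≤c) i<k)

  block-ignores : ∀ lo k c → c <ℕ lo ⊎ lo +ℕ k ≤ c → Ignores c (block lo k)
  block-ignores lo zero          c outside R b = refl
  block-ignores lo (suc zero)    c outside     = Ignores-1- c (X-ignores c≢lo)
    where
      c≢lo : c ≢ lo
      c≢lo c≡lo = outside-≢ 0 (s≤s z≤n) outside (≡.trans c≡lo (≡.sym (NP.+-identityʳ lo)))
  block-ignores lo (suc (suc k)) c outside     =
    Ignores-* c (Ignores-1- c (Ignores-* c (X-ignores c≢lo) (X-ignores c≢hi)))
                (block-ignores (suc lo) k c inner-outside)
    where
      c≢lo : c ≢ lo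
      c≢lo c≡lo = outside-≢ 0 (s≤s z≤n) outside (≡.trans c≡lo (≡.sym (NP.+-identityʳ lo)))
      c≢hi : c ≢ suc (lo +ℕ k)
      c≢hi c≡hi = outside-≢ (suc k) (NP.n<1+n (suc k)) outside (≡.trans c≡hi (≡.sym (NP.+-suc lo k)))
      inner-outside : c <ℕ suc lo ⊎ suc lo +ℕ k ≤ c
      inner-outside = Sum.map NP.m<n⇒m<1+n shrink outside
        where
          shrink : lo +ℕ suc (suc k) ≤ c → suc lo +ℕ k ≤ c
          shrink = NP.≤-trans (NP.≤-trans (NP.n≤1+n _) (NP.≤-reflexive (≡.sym (+-suc² lo k))))

  block-nonneg : ∀ lo k R → 0# ≤ᶠ block lo k R
  block-nonneg lo zero          R = 0≤1
  block-nonneg lo (suc zero)    R = 1-indicator-nonneg (get (A R) lo)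
  block-nonneg lo (suc (suc k)) R =
    *-nonneg (1-indicator²-nonneg (get (A R) lo) (get (A R) (suc (lo +ℕ k)))) (block-nonneg (suc lo) k R)

  block-absent : ∀ lo k s R → inSumsetShift (A R) s ≡ false → lo +ℕ lo +ℕ k ≡ s → block lo k R ≈ 1#
  block-absent lo zero          s R t∉A+A _  = refl
  block-absent lo (suc zero)    s R t∉A+A ≡.refl = begin-equality
    1# - indicator (get (A R) lo)  ≡⟨ ≡.cong (λ v → 1# - indicator v) lo∉A ⟩
    1# - indicator false           ≈⟨ 1-indicator-false ⟩
    1#                             ∎
    where
      lo∉A : get (A R) lo ≡ false
      lo∉A = ∧-idem-false (sumset-absent (A R) lo lo _ t∉A+A (NP.+-comm 1 (lo +ℕ lo)))
  block-absent lo (suc (suc k)) s R t∉A+A ≡.refl = begin-equality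
    (1# - X lo R * X hi R) * block (suc lo) k R
      ≈⟨ *-cong (+-cong refl (-‿cong (indicator-∧ (get (A R) lo) (get (A R) hi))))
                (block-absent (suc lo) k _ R t∉A+A (inner-sum lo k)) ⟩
    (1# - indicator (get (A R) lo ∧ get (A R) hi)) * 1#
      ≡⟨ ≡.cong (λ v → (1# - indicator v) * 1#) (sumset-absent (A R) lo hi _ t∉A+A (pair-sum lo k)) ⟩
    (1# - indicator false) * 1#  ≈⟨ *-identityʳ _ ⟩
    1# - indicator false         ≈⟨ 1-indicator-false ⟩
    1#                           ∎
    where
      hi : ℕ
      hi = suc (lo +ℕ k)
      pair-sum : ∀ lo k → suc (lo +ℕ suc (lo +ℕ k)) ≡ lo +ℕ lo +ℕ suc (suc k)
      pair-sum = solve-∀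
      inner-sum : ∀ lo k → suc lo +ℕ suc lo +ℕ k ≡ lo +ℕ lo +ℕ suc (suc k)
      inner-sum = solve-∀

  failure≤block : ∀ lo k s R → lo +ℕ lo +ℕ k ≡ s → 1# - indicator (inSumsetShift (A R) s) ≤ᶠ block lo k R
  failure≤block lo k s R s≡ with inSumsetShift (A R) s in e
  ... | true  = begin
    1# - indicator true ≈⟨ 1-indicator-true ⟩
    0#                  ≤⟨ block-nonneg lo k R ⟩
    block lo k R        ∎
  ... | false = inj₂ (trans 1-indicator-false (sym (block-absent lo k s R e s≡)))


module PairSeries {c ℓ₁ ℓ₂ : Level} (F : OrderedField c ℓ₁ ℓ₂) (p : OrderedField.Carrier F)
                  (0<p : OrderedField._<_ F (OrderedField.0# F) p)
                  (p<1 : OrderedField._<_ F p (OrderedField.1# F)) where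
  open OrderedFieldProperties F
  open ≤-Reasoning
  open FiniteSums F

  q : Carrier
  q = 1# - p

  q+p≈1 : q + p ≈ 1#
  q+p≈1 = -‿+-cancel p 1#

  0<q : 0# < q
  0<q = <⇒0<- p<1

  -- Probability that a pair of middle positions is not contained in A.
  r : Carrier
  r = 1# - p * p

  -- noPairs k is the probability that a block of k middle positions has no
  -- pair in A: each of the ⌊k/2⌋ pairs contributes r, a centre contributes q.
  noPairs : ℕ → Carrier
  noPairs zero          = 1#
  noPairs (suc zero)    = q
  noPairs (suc (suc k)) = r * noPairs k

  0<r : 0# < r
  0<r = <⇒0<- (begin-strict
    p * p  <⟨ *-monoˡ-< 0<p p<1 ⟩
    p * 1# ≈⟨ *-identityʳ p ⟩
    p      <⟨ p<1 ⟩
    1#     ∎)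

  0<p² : 0# < p ^ 2
  0<p² = *-pos 0<p (*-pos 0<p 0<1)

  D : Carrier
  D = (1# + q) * ((p ^ 2) ⁻¹)

  0<D : 0# < D
  0<D = *-pos (begin-strict 0# <⟨ 0<1 ⟩ 1# ≈⟨ +-identityʳ 1# ⟨ 1# + 0# <⟨ +-monoʳ-< 1# 0<q ⟩ 1# + q ∎)
              (x⁻¹-pos 0<p²)

  D-fixed : 1# + (q + r * D) ≈ D
  D-fixed = begin-equality
    1# + (q + r * D)     ≈⟨ +-assoc 1# q (r * D) ⟨
    (1# + q) + r * D     ≈⟨ +-cong D*p² (*-comm D r) ⟨
    D * p ^ 2 + D * r    ≈⟨ distribˡ D (p ^ 2) r ⟨
    D * (p ^ 2 + r)      ≈⟨ *-cong refl p²+r≈1 ⟩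
    D * 1#               ≈⟨ *-identityʳ D ⟩
    D                    ∎
    where
      D*p² : D * p ^ 2 ≈ 1# + q
      D*p² = begin-equality
        (1# + q) * ((p ^ 2) ⁻¹) * p ^ 2   ≈⟨ *-assoc _ _ _ ⟩
        (1# + q) * ((p ^ 2) ⁻¹ * p ^ 2)   ≈⟨ *-cong refl (trans (*-comm _ _) (x⁻¹-inverse 0<p²)) ⟩
        (1# + q) * 1#                     ≈⟨ *-identityʳ _ ⟩
        1# + q                            ∎
      p²+r≈1 : p ^ 2 + r ≈ 1#
      p²+r≈1 = trans (+-cong (*-cong refl (*-identityʳ p)) refl)
                     (trans (+-comm _ _) (-‿+-cancel (p * p) 1#))

  noPairs-sum< : ∀ m → Σᵣ.fold m noPairs < D
  noPairs-sum< zero          = 0<D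
  noPairs-sum< (suc zero)    = begin-strict
    1# + 0#           ≈⟨ +-cong refl (+-identityʳ 0#) ⟨
    1# + (0# + 0#)    <⟨ +-monoʳ-< 1# (+-mono-< 0<q (*-pos 0<r 0<D)) ⟩
    1# + (q + r * D)  ≈⟨ D-fixed ⟩
    D                 ∎
  noPairs-sum< (suc (suc m)) = begin-strict
    1# + (q + Σᵣ.fold m (λ k → r * noPairs k)) ≈⟨ +-cong refl (+-cong refl (Σᵣ-scale m r noPairs)) ⟩
    1# + (q + r * Σᵣ.fold m noPairs)           <⟨ +-monoʳ-< 1# (+-monoʳ-< q (*-monoˡ-< 0<r (noPairs-sum< m))) ⟩
    1# + (q + r * D)                           ≈⟨ D-fixed ⟩
    D                                          ∎

module Model {c ℓ₁ ℓ₂ : Level} (F : OrderedField c ℓ₁ ℓ₂)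
             (n ℓ u : ℕ) (ℓ+u≤n : ℓ +ℕ u ≤ n)
             (p : OrderedField.Carrier F) (0<p : OrderedField._<_ F (OrderedField.0# F) p)
             (p<1 : OrderedField._<_ F p (OrderedField.1# F))
             (L U : Subset n)
             (L-low : ∀ i → i ∈ L → toℕ i <ℕ ℓ) (U-high : ∀ i → i ∈ U → n ∸ u ≤ toℕ i) where
  open OrderedFieldProperties F
  open ≤-Reasoning
  open ProductMeasure F
  open Indicators F
  open Blocks F L U
  open PairSeries F p 0<p p<1
  open FiniteSums F
  module Πᵣ = RangeFold *-commutativeMonoid

  N : ℕ
  N = n ∸ u

  middle? : ℕ → Bool
  middle? k = (ℓ ≤ᵇ k) ∧ (suc k ≤ᵇ N)

  ω : Weights
  ω k b = if middle? k then (if b then p else q) else (if b then 0# else 1#)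

  ω-normalised : Normalised ω
  ω-normalised k with middle? k
  ... | true  = q+p≈1
  ... | false = +-identityʳ 1#

  ω-nonneg : NonNegative ω
  ω-nonneg k b with middle? k | b
  ... | true  | true  = <⇒≤ 0<p
  ... | true  | false = <⇒≤ 0<q
  ... | false | true  = inj₂ refl
  ... | false | false = 0≤1

  Exp : (Subset n → Carrier) → Carrier
  Exp = E n ω

  probCovered≈Exp : probCovered F p n ℓ u L U ≈ Exp (λ R → indicator (coveredEvent n ℓ u (A R)))
  probCovered≈Exp = E-as-sum n ω _

  ℓ≤N : ℓ ≤ N
  ℓ≤N = NP.≤-trans (NP.≤-reflexive (≡.sym (NP.m+n∸n≡m ℓ u))) (NP.∸-monoˡ-≤ u ℓ+u≤n)

  middle?-true : ∀ {x} → ℓ ≤ x → suc x ≤ N → middle? x ≡ true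
  middle?-true ℓ≤x x<N = ≡.cong₂ _∧_ (≤ᵇ-true ℓ≤x) (≤ᵇ-true x<N)

  middle?-low : ∀ {x} → x <ℕ ℓ → middle? x ≡ false
  middle?-low x<ℓ = ≡.cong (_∧ _) (≤ᵇ-false (NP.<⇒≱ x<ℓ))

  middle?-high : ∀ {x} → N ≤ x → middle? x ≡ false
  middle?-high {x} N≤x = ≡.trans (≡.cong ((ℓ ≤ᵇ x) ∧_) (≤ᵇ-false (NP.<⇒≱ (s≤s N≤x)))) (∧-zeroʳ _)

  L-false : ∀ {x} → ℓ ≤ x → get L x ≡ false
  L-false {x} ℓ≤x = get-outside L (_<ℕ ℓ) L-low x (NP.≤⇒≯ ℓ≤x)

  U-false : ∀ {x} → x <ℕ N → get U x ≡ false
  U-false {x} x<N = get-outside U (N ≤_) U-high x (NP.<⇒≱ x<N)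

  π : ℕ → Carrier
  π x = Exp (X x)

  X-given : ℕ → Bool → Carrier
  X-given x v = indicator ((get L x ∨ v) ∨ get U x)

  π-law : ∀ {x} → x <ℕ n → π x ≈ ω x false * X-given x false + ω x true * X-given x true
  π-law {x} x<n = trans (E-cong n ω (λ R → reflexive (≡.cong indicator (get-A R x))))
                        (E-coordinate n ω ω-normalised x x<n (X-given x))

  π-middle : ∀ {x} → ℓ ≤ x → suc x ≤ N → π x ≈ p
  π-middle {x} ℓ≤x x<N = begin-equality
    π x                                                ≈⟨ π-law (NP.<-≤-trans x<N (NP.m∸n≤m n u)) ⟩
    ω x false * X-given x false + ω x true * X-given x true
      ≡⟨ ≡.cong (λ m → (if m then q else 1#) * X-given x false + (if m then p else 0#) * X-given x true)
                (middle?-true ℓ≤x x<N) ⟩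
    q * X-given x false + p * X-given x true
      ≡⟨ ≡.cong₂ (λ a b → q * indicator ((a ∨ false) ∨ b) + p * indicator ((a ∨ true) ∨ b))
                 (L-false ℓ≤x) (U-false x<N) ⟩
    q * 0# + p * 1#                                    ≈⟨ +-cong (zeroʳ q) (*-identityʳ p) ⟩
    0# + p                                             ≈⟨ +-identityˡ p ⟩
    p                                                  ∎

  π-fixed : ∀ {x} → x <ℕ n → middle? x ≡ false → π x ≈ X-given x false
  π-fixed {x} x<n outside = begin-equality
    π x                                                ≈⟨ π-law x<n ⟩
    ω x false * X-given x false + ω x true * X-given x true
      ≡⟨ ≡.cong (λ m → (if m then q else 1#) * X-given x false + (if m then p else 0#) * X-given x true) outside ⟩
    1# * X-given x false + 0# * X-given x true         ≈⟨ +-cong (*-identityˡ _) (zeroˡ _) ⟩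
    X-given x false + 0#                               ≈⟨ +-identityʳ _ ⟩
    X-given x false                                    ∎

  π-low : ∀ {x} → x <ℕ ℓ → π x ≈ indicator (get L x)
  π-low {x} x<ℓ = trans (π-fixed x<n (middle?-low x<ℓ))
    (reflexive (≡.cong indicator (≡.trans (≡.cong (λ b → (get L x ∨ false) ∨ b) (U-false (NP.<-≤-trans x<ℓ ℓ≤N)))
                                          (≡.trans (∨-identityʳ _) (∨-identityʳ _)))))
    where
      x<n : x <ℕ n
      x<n = NP.<-≤-trans x<ℓ (NP.≤-trans ℓ≤N (NP.m∸n≤m n u))

  π-high : ∀ {x} → N ≤ x → x <ℕ n → π x ≈ indicator (get U x)
  π-high {x} N≤x x<n = trans (π-fixed x<n (middle?-high N≤x))
    (reflexive (≡.cong (λ a → indicator ((a ∨ false) ∨ get U x)) (L-false (NP.≤-trans ℓ≤N N≤x))))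

  -- Distinct positions lie in A independently.
  Exp-pair : ∀ {x z} → x ≢ z → Exp (λ R → 1# - X x R * X z R) ≈ 1# - π x * π z
  Exp-pair {x} {z} x≢z = trans (E-complement n ω ω-normalised _)
    (+-cong refl (-‿cong (E-factor n ω ω-normalised (X x) (X z) separate)))
    where
      separate : ∀ k → Ignores k (X x) ⊎ Ignores k (X z)
      separate k with k ≟ x
      ... | yes ≡.refl = inj₂ (X-ignores x≢z)
      ... | no  k≢x    = inj₁ (X-ignores k≢x)

  Exp-block-step : ∀ lo k → Exp (block lo (suc (suc k))) ≈ (1# - π lo * π (suc (lo +ℕ k))) * Exp (block (suc lo) k)
  Exp-block-step lo k = trans (E-factor n ω ω-normalised _ (block (suc lo) k) separate)
                              (*-cong (Exp-pair (NP.m≢1+m+n lo)) refl)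
    where
      hi : ℕ
      hi = suc (lo +ℕ k)
      separate : ∀ c → Ignores c (λ R → 1# - X lo R * X hi R) ⊎ Ignores c (block (suc lo) k)
      separate c with c ≟ lo | c ≟ hi
      ... | yes ≡.refl | _          = inj₂ (block-ignores (suc lo) k c (inj₁ (NP.n<1+n lo)))
      ... | no  _      | yes ≡.refl = inj₂ (block-ignores (suc lo) k c (inj₂ NP.≤-refl))
      ... | no  c≢lo   | no  c≢hi   = inj₁ (Ignores-1- c (Ignores-* c (X-ignores c≢lo) (X-ignores c≢hi)))

  Exp-block-single : ∀ lo → Exp (block lo 1) ≈ 1# - π lo
  Exp-block-single lo = E-complement n ω ω-normalised (X lo)

  Exp-middle-block : ∀ lo k → ℓ ≤ lo → lo +ℕ k ≤ N → Exp (block lo k) ≈ noPairs k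
  Exp-middle-block lo zero          ℓ≤lo _    = E-const n ω ω-normalised 1#
  Exp-middle-block lo (suc zero)    ℓ≤lo in-N = begin-equality
    Exp (block lo 1) ≈⟨ Exp-block-single lo ⟩
    1# - π lo        ≈⟨ +-cong refl (-‿cong (π-middle ℓ≤lo (NP.≤-trans (NP.≤-reflexive (NP.+-comm 1 lo)) in-N))) ⟩
    q                ∎
  Exp-middle-block lo (suc (suc k)) ℓ≤lo in-N = begin-equality
    Exp (block lo (suc (suc k)))                         ≈⟨ Exp-block-step lo k ⟩
    (1# - π lo * π (suc (lo +ℕ k))) * Exp (block (suc lo) k)
      ≈⟨ *-cong (+-cong refl (-‿cong (*-cong (π-middle ℓ≤lo lo<N) (π-middle ℓ≤hi hi<N))))
                (Exp-middle-block (suc lo) k (NP.m≤n⇒m≤1+n ℓ≤lo) (NP.<⇒≤ hi<N)) ⟩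
    r * noPairs k                                        ∎
    where
      hi<N : suc (suc (lo +ℕ k)) ≤ N
      hi<N = NP.≤-trans (NP.≤-reflexive (≡.sym (+-suc² lo k))) in-N
      lo<N : suc lo ≤ N
      lo<N = NP.≤-trans (s≤s (NP.m≤m+n lo k)) (NP.<⇒≤ hi<N)
      ℓ≤hi : ℓ ≤ suc (lo +ℕ k)
      ℓ≤hi = NP.≤-trans ℓ≤lo (NP.≤-trans (NP.m≤m+n lo k) (NP.n≤1+n _))

  Exp-peel : ∀ m lo k s → lo +ℕ lo +ℕ (m +ℕ m +ℕ k) ≡ s →
    Exp (block lo (m +ℕ m +ℕ k))
      ≈ Πᵣ.fold m (λ j → 1# - π (lo +ℕ j) * π (s ∸ suc (lo +ℕ j))) * Exp (block (lo +ℕ m) k)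
  Exp-peel zero    lo k s _ = begin-equality
    Exp (block lo k)               ≡⟨ ≡.cong (λ a → Exp (block a k)) (NP.+-identityʳ lo) ⟨
    Exp (block (lo +ℕ 0) k)        ≈⟨ *-identityˡ _ ⟨
    1# * Exp (block (lo +ℕ 0) k)   ∎
  Exp-peel (suc m) lo k s ≡.refl = begin-equality
    Exp (block lo (suc m +ℕ suc m +ℕ k))
      ≡⟨ ≡.cong (λ K → Exp (block lo K)) (double-suc m k) ⟩
    Exp (block lo (suc (suc K)))
      ≈⟨ Exp-block-step lo K ⟩
    head * Exp (block (suc lo) K)
      ≈⟨ *-cong refl (Exp-peel m (suc lo) k _ (inner-sum lo m k)) ⟩
    head * (Πᵣ.fold m (λ j → factor (suc lo +ℕ j)) * Exp (block (suc lo +ℕ m) k))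
      ≈⟨ *-assoc _ _ _ ⟨
    (head * Πᵣ.fold m (λ j → factor (suc lo +ℕ j))) * Exp (block (suc lo +ℕ m) k)
      ≈⟨ *-cong (*-cong head≈ (Πᵣ.fold-cong m (λ j _ → reflexive (≡.cong factor (≡.sym (NP.+-suc lo j))))))
                (reflexive (≡.cong (λ a → Exp (block a k)) (≡.sym (NP.+-suc lo m)))) ⟩
    Πᵣ.fold (suc m) (λ j → factor (lo +ℕ j)) * Exp (block (lo +ℕ suc m) k) ∎
    where
      K : ℕ
      K = m +ℕ m +ℕ k
      factor : ℕ → Carrier
      factor x = 1# - π x * π (s ∸ suc x)
      head : Carrier
      head = 1# - π lo * π (suc (lo +ℕ K))
      double-suc : ∀ m k → suc m +ℕ suc m +ℕ k ≡ suc (suc (m +ℕ m +ℕ k))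
      double-suc = solve-∀
      inner-sum : ∀ lo m k → suc lo +ℕ suc lo +ℕ (m +ℕ m +ℕ k) ≡ lo +ℕ lo +ℕ (suc m +ℕ suc m +ℕ k)
      inner-sum = solve-∀
      outer-partner : ∀ lo m k → lo +ℕ lo +ℕ (suc m +ℕ suc m +ℕ k) ∸ suc (lo +ℕ 0) ≡ suc (lo +ℕ (m +ℕ m +ℕ k))
      outer-partner lo m k = ≡.trans (≡.cong (_∸ suc (lo +ℕ 0)) (split-sum lo m k))
                                     (NP.m+n∸m≡n (suc (lo +ℕ 0)) (suc (lo +ℕ (m +ℕ m +ℕ k))))
        where
          split-sum : ∀ lo m k → lo +ℕ lo +ℕ (suc m +ℕ suc m +ℕ k) ≡ suc (lo +ℕ 0) +ℕ suc (lo +ℕ (m +ℕ m +ℕ k))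
          split-sum = solve-∀
      head≈ : head ≈ factor (lo +ℕ 0)
      head≈ = reflexive (≡.cong₂ (λ a b → 1# - π a * π b) (≡.sym (NP.+-identityʳ lo)) (≡.sym (outer-partner lo m k)))

  -- The factor 1 - [y ∈ V] p of an anchor pair joining y to a middle position:
  -- q when y ∈ V, and 1 otherwise.
  avoid : ∀ {m} → Subset m → ℕ → Carrier
  avoid V y = 1# - indicator (get V y) * p

  avoid-false : ∀ {m} (V : Subset m) {y} → get V y ≡ false → avoid V y ≈ 1#
  avoid-false V V-y = begin-equality
    1# - indicator (get V _) * p ≡⟨ ≡.cong (λ b → 1# - indicator b * p) V-y ⟩
    1# - 0# * p                  ≈⟨ +-cong refl (-‿cong (zeroˡ p)) ⟩
    1# - 0#                      ≈⟨ 1-indicator-false ⟩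
    1#                           ∎

  avoid-all : ∀ {m} (V : Subset m) → Πᵣ.fold m (avoid V) ≈ q ^ ∣ V ∣
  avoid-all []          = refl
  avoid-all (true ∷ V)  = *-cong (+-cong refl (-‿cong (*-identityˡ p))) (avoid-all V)
  avoid-all (false ∷ V) = trans (*-cong (avoid-false (false ∷ V) {0} ≡.refl) (avoid-all V)) (*-identityˡ _)

  avoid-window : (V : Subset n) (a m : ℕ) → a +ℕ m ≤ n →
                 (∀ x → x <ℕ a ⊎ a +ℕ m ≤ x → get V x ≡ false) →
                 Πᵣ.fold m (λ j → avoid V (a +ℕ j)) ≈ q ^ ∣ V ∣
  avoid-window V a m a+m≤n V-window = begin-equality
    Πᵣ.fold m (λ j → avoid V (a +ℕ j))
      ≈⟨ *-identityʳ _ ⟨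
    Πᵣ.fold m (λ j → avoid V (a +ℕ j)) * 1#
      ≈⟨ *-cong refl (Πᵣ.fold-ε rest _ (λ j _ → avoid-false V (V-window _ (inj₂ (beyond j))))) ⟨
    Πᵣ.fold m (λ j → avoid V (a +ℕ j)) * Πᵣ.fold rest (λ j → avoid V (a +ℕ (m +ℕ j)))
      ≈⟨ Πᵣ.fold-split m rest (λ j → avoid V (a +ℕ j)) ⟨
    Πᵣ.fold (m +ℕ rest) (λ j → avoid V (a +ℕ j))
      ≈⟨ *-identityˡ _ ⟨
    1# * Πᵣ.fold (m +ℕ rest) (λ j → avoid V (a +ℕ j))
      ≈⟨ *-cong (Πᵣ.fold-ε a _ (λ x x<a → avoid-false V (V-window x (inj₁ x<a)))) refl ⟨
    Πᵣ.fold a (avoid V) * Πᵣ.fold (m +ℕ rest) (λ j → avoid V (a +ℕ j))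
      ≈⟨ Πᵣ.fold-split a (m +ℕ rest) (avoid V) ⟨
    Πᵣ.fold (a +ℕ (m +ℕ rest)) (avoid V)
      ≡⟨ ≡.cong (λ k → Πᵣ.fold k (avoid V)) (≡.trans (≡.sym (NP.+-assoc a m rest)) (NP.m+[n∸m]≡n a+m≤n)) ⟩
    Πᵣ.fold n (avoid V)
      ≈⟨ avoid-all V ⟩
    q ^ ∣ V ∣ ∎
    where
      rest : ℕ
      rest = n ∸ (a +ℕ m)
      beyond : ∀ j → a +ℕ m ≤ a +ℕ (m +ℕ j)
      beyond j = NP.≤-trans (NP.m≤m+n (a +ℕ m) j) (NP.≤-reflexive (NP.+-assoc a m j))

  missing : ℕ → Subset n → Carrier
  missing s R = 1# - indicator (inSumsetShift (A R) s)

  Exp-missing≤block : ∀ lo k s → lo +ℕ lo +ℕ k ≡ s → Exp (missing s) ≤ᶠ Exp (block lo k)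
  Exp-missing≤block lo k s s≡ = E-mono n ω ω-nonneg (λ R → failure≤block lo k s R s≡)

  u≤n : u ≤ n
  u≤n = NP.≤-trans (NP.m≤n+m u ℓ) ℓ+u≤n

  N+u≡n : N +ℕ u ≡ n
  N+u≡n = NP.m∸n+n≡m u≤n

  L-window : ∀ x → x <ℕ 0 ⊎ 0 +ℕ ℓ ≤ x → get L x ≡ false
  L-window x (inj₂ ℓ≤x) = L-false ℓ≤x

  U-window : ∀ x → x <ℕ N ⊎ N +ℕ u ≤ x → get U x ≡ false
  U-window x (inj₁ x<N) = U-false x<N
  U-window x (inj₂ n≤x) = get-beyond U x (NP.≤-trans (NP.≤-reflexive (≡.sym N+u≡n)) n≤x)

  -- Positions of a lower target s = 2ℓ+i ≤ N (that is, t = 2ℓ-1+i): the block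
  -- starts at 0, its ℓ outer pairs join y < ℓ to the middle position s-1-y,
  -- and its core consists of the i middle positions ℓ, …, ℓ+i-1.
  module LowerTarget (i : ℕ) (s≤N : 2 *ℕ ℓ +ℕ i ≤ N) where
    s : ℕ
    s = 2 *ℕ ℓ +ℕ i

    sum-eq : 0 +ℕ 0 +ℕ (ℓ +ℕ ℓ +ℕ i) ≡ s
    sum-eq = regroup ℓ i
      where
        regroup : ∀ ℓ i → 0 +ℕ 0 +ℕ (ℓ +ℕ ℓ +ℕ i) ≡ 2 *ℕ ℓ +ℕ i
        regroup = solve-∀

    s∸ℓ : s ∸ ℓ ≡ ℓ +ℕ i
    s∸ℓ = ≡.trans (≡.cong (_∸ ℓ) (double ℓ i)) (NP.m+n∸m≡n ℓ (ℓ +ℕ i))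
      where
        double : ∀ ℓ i → 2 *ℕ ℓ +ℕ i ≡ ℓ +ℕ (ℓ +ℕ i)
        double = solve-∀

    ℓ+i≤N : ℓ +ℕ i ≤ N
    ℓ+i≤N = NP.≤-trans (NP.≤-reflexive (≡.sym s∸ℓ)) (NP.≤-trans (NP.m∸n≤m s ℓ) s≤N)

    ℓ≤s : ℓ ≤ s
    ℓ≤s = NP.≤-trans (NP.m≤m+n ℓ i) (NP.≤-trans (NP.≤-reflexive (≡.sym s∸ℓ)) (NP.m∸n≤m s ℓ))

    -- The partner s-1-j of an anchor j < ℓ is a middle position.
    anchor : ∀ j → j <ℕ ℓ → 1# - π j * π (s ∸ suc j) ≈ avoid L j
    anchor j j<ℓ = +-cong refl (-‿cong (*-cong (π-low j<ℓ) (π-middle ℓ≤partner partner<N)))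
      where
        ℓ≤partner : ℓ ≤ s ∸ suc j
        ℓ≤partner = NP.≤-trans (NP.m≤m+n ℓ i) (NP.≤-trans (NP.≤-reflexive (≡.sym s∸ℓ)) (NP.∸-monoʳ-≤ s j<ℓ))
        partner<N : suc (s ∸ suc j) ≤ N
        partner<N = NP.≤-trans (NP.∸-monoʳ-< {o = 0} (s≤s z≤n) (NP.≤-trans j<ℓ ℓ≤s)) s≤N

  lower-target : ∀ i → 2 *ℕ ℓ +ℕ i ≤ N → Exp (missing (2 *ℕ ℓ +ℕ i)) ≤ᶠ q ^ ∣ L ∣ * noPairs i
  lower-target i s≤N = begin
    Exp (missing s)                                ≤⟨ Exp-missing≤block 0 (ℓ +ℕ ℓ +ℕ i) s sum-eq ⟩
    Exp (block 0 (ℓ +ℕ ℓ +ℕ i))                    ≈⟨ Exp-peel ℓ 0 i s sum-eq ⟩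
    Πᵣ.fold ℓ (λ j → 1# - π j * π (s ∸ suc j)) * Exp (block ℓ i)
      ≈⟨ *-cong (Πᵣ.fold-cong ℓ anchor) (Exp-middle-block ℓ i NP.≤-refl ℓ+i≤N) ⟩
    Πᵣ.fold ℓ (λ j → avoid L (0 +ℕ j)) * noPairs i
      ≈⟨ *-cong (avoid-window L 0 ℓ (NP.≤-trans ℓ≤N (NP.m∸n≤m n u)) L-window) refl ⟩
    q ^ ∣ L ∣ * noPairs i                          ∎
    where open LowerTarget i s≤N

  -- Positions of an upper target s = n+ℓ+i ≤ 2N (that is, t = n+ℓ-1+i): the
  -- block starts at lo = ℓ+i, its u outer pairs join the middle positions
  -- lo+j to the positions n-1-j ≥ N, and its core of length k = 2N - s runs
  -- from a = ℓ+i+u up to N - 1.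
  module UpperTarget (i : ℕ) (s≤T : n +ℕ ℓ +ℕ i ≤ 2 *ℕ n ∸ 2 *ℕ u) where
    s lo a k : ℕ
    s  = n +ℕ ℓ +ℕ i
    lo = ℓ +ℕ i
    a  = lo +ℕ u
    k  = 2 *ℕ n ∸ 2 *ℕ u ∸ s

    s≡N+a : s ≡ N +ℕ a
    s≡N+a = ≡.trans (≡.cong (λ m → m +ℕ ℓ +ℕ i) (≡.sym N+u≡n)) (regroup N u ℓ i)
      where
        regroup : ∀ N u ℓ i → N +ℕ u +ℕ ℓ +ℕ i ≡ N +ℕ (ℓ +ℕ i +ℕ u)
        regroup = solve-∀

    T≡N+N : 2 *ℕ n ∸ 2 *ℕ u ≡ N +ℕ N
    T≡N+N = ≡.trans (≡.sym (NP.*-distribˡ-∸ 2 n u)) (double N)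
      where
        double : ∀ N → 2 *ℕ N ≡ N +ℕ N
        double = solve-∀

    a≤N : a ≤ N
    a≤N = NP.+-cancelˡ-≤ N a N (NP.≤-trans (NP.≤-reflexive (≡.sym s≡N+a)) (NP.≤-trans s≤T (NP.≤-reflexive T≡N+N)))

    a+k≡N : a +ℕ k ≡ N
    a+k≡N = ≡.trans (≡.cong (a +ℕ_) (≡.trans (≡.cong₂ _∸_ T≡N+N s≡N+a) (NP.[m+n]∸[m+o]≡n∸o N N a)))
                    (NP.m+[n∸m]≡n a≤N)

    sum-eq : lo +ℕ lo +ℕ (u +ℕ u +ℕ k) ≡ s
    sum-eq = ≡.trans (regroup ℓ i u k) (≡.trans (≡.cong (a +ℕ_) a+k≡N) (≡.trans (NP.+-comm a N) (≡.sym s≡N+a)))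
      where
        regroup : ∀ ℓ i u k → ℓ +ℕ i +ℕ (ℓ +ℕ i) +ℕ (u +ℕ u +ℕ k) ≡ ℓ +ℕ i +ℕ u +ℕ (ℓ +ℕ i +ℕ u +ℕ k)
        regroup = solve-∀

    ℓ≤a : ℓ ≤ a
    ℓ≤a = NP.≤-trans (NP.m≤m+n ℓ i) (NP.m≤m+n lo u)

    -- The partner of the middle position lo+j is N + (u-1-j) = n-1-j.
    partner≡ : ∀ j → j <ℕ u → s ∸ suc (lo +ℕ j) ≡ N +ℕ (u ∸ suc j)
    partner≡ j j<u =
      ≡.trans (≡.cong₂ _∸_ s≡N+a (≡.sym (NP.+-suc lo j)))          -- (N + (lo + u)) ∸ (lo + suc j)
      (≡.trans (≡.cong (_∸ (lo +ℕ suc j)) (swap-middle N lo u))      -- (lo + (N + u)) ∸ (lo + suc j)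
      (≡.trans (NP.[m+n]∸[m+o]≡n∸o lo (N +ℕ u) (suc j))              -- (N + u) ∸ suc j
               (NP.+-∸-assoc N j<u)))
      where
        swap-middle : ∀ N lo u → N +ℕ (lo +ℕ u) ≡ lo +ℕ (N +ℕ u)
        swap-middle = solve-∀

    anchor : ∀ j → j <ℕ u → 1# - π (lo +ℕ j) * π (s ∸ suc (lo +ℕ j)) ≈ avoid U (N +ℕ (u ∸ suc j))
    anchor j j<u = begin-equality
      1# - π (lo +ℕ j) * π (s ∸ suc (lo +ℕ j))
        ≡⟨ ≡.cong (λ x → 1# - π (lo +ℕ j) * π x) (partner≡ j j<u) ⟩
      1# - π (lo +ℕ j) * π (N +ℕ (u ∸ suc j))
        ≈⟨ +-cong refl (-‿cong (*-cong (π-middle (NP.≤-trans (NP.m≤m+n ℓ i) (NP.m≤m+n lo j)) lo+j<N)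
                                        (π-high (NP.m≤m+n N _) partner<n))) ⟩
      1# - p * indicator (get U (N +ℕ (u ∸ suc j)))
        ≈⟨ +-cong refl (-‿cong (*-comm _ _)) ⟩
      avoid U (N +ℕ (u ∸ suc j)) ∎
      where
        lo+j<N : suc (lo +ℕ j) ≤ N
        lo+j<N = NP.≤-trans (NP.+-monoʳ-< lo j<u) a≤N
        partner<n : N +ℕ (u ∸ suc j) <ℕ n
        partner<n = NP.≤-trans (NP.+-monoʳ-< N (NP.∸-monoʳ-< {o = 0} (s≤s z≤n) j<u)) (NP.≤-reflexive N+u≡n)

  upper-target : ∀ i → n +ℕ ℓ +ℕ i ≤ 2 *ℕ n ∸ 2 *ℕ u →
                 Exp (missing (n +ℕ ℓ +ℕ i)) ≤ᶠ q ^ ∣ U ∣ * noPairs (2 *ℕ n ∸ 2 *ℕ u ∸ (n +ℕ ℓ +ℕ i))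
  upper-target i s≤T = begin
    Exp (missing s)                      ≤⟨ Exp-missing≤block lo (u +ℕ u +ℕ k) s sum-eq ⟩
    Exp (block lo (u +ℕ u +ℕ k))         ≈⟨ Exp-peel u lo k s sum-eq ⟩
    Πᵣ.fold u (λ j → 1# - π (lo +ℕ j) * π (s ∸ suc (lo +ℕ j))) * Exp (block a k)
      ≈⟨ *-cong (Πᵣ.fold-cong u anchor) (Exp-middle-block a k ℓ≤a (NP.≤-reflexive a+k≡N)) ⟩
    Πᵣ.fold u (λ j → avoid U (N +ℕ (u ∸ suc j))) * noPairs k
      ≈⟨ *-cong (trans (Πᵣ.fold-reverse u (λ j → avoid U (N +ℕ j)))
                       (avoid-window U N u (NP.≤-reflexive N+u≡n) U-window)) refl ⟩
    q ^ ∣ U ∣ * noPairs k                ∎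
    where open UpperTarget i s≤T

  m₁ m₂ : ℕ
  m₁ = suc N ∸ 2 *ℕ ℓ
  m₂ = suc (2 *ℕ n ∸ 2 *ℕ u) ∸ (n +ℕ ℓ)

  lower-sum : Σᵣ.fold m₁ (λ i → Exp (missing (2 *ℕ ℓ +ℕ i))) ≤ᶠ q ^ ∣ L ∣ * Σᵣ.fold m₁ noPairs
  lower-sum = begin
    Σᵣ.fold m₁ (λ i → Exp (missing (2 *ℕ ℓ +ℕ i)))
      ≤⟨ Σᵣ-mono m₁ (λ i i<m₁ → lower-target i (interval-index _ N i i<m₁)) ⟩
    Σᵣ.fold m₁ (λ i → q ^ ∣ L ∣ * noPairs i)       ≈⟨ Σᵣ-scale m₁ _ noPairs ⟩
    q ^ ∣ L ∣ * Σᵣ.fold m₁ noPairs                 ∎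

  -- The upper targets contribute the terms of the series in reverse order.
  upper-sum : Σᵣ.fold m₂ (λ i → Exp (missing (n +ℕ ℓ +ℕ i))) ≤ᶠ q ^ ∣ U ∣ * Σᵣ.fold m₂ noPairs
  upper-sum = begin
    Σᵣ.fold m₂ (λ i → Exp (missing (n +ℕ ℓ +ℕ i)))
      ≤⟨ Σᵣ-mono m₂ (λ i i<m₂ → upper-target i (interval-index _ (2 *ℕ n ∸ 2 *ℕ u) i i<m₂)) ⟩
    Σᵣ.fold m₂ (λ i → q ^ ∣ U ∣ * noPairs (2 *ℕ n ∸ 2 *ℕ u ∸ (n +ℕ ℓ +ℕ i)))
      ≈⟨ Σᵣ.fold-cong m₂ (λ i _ → reflexive (≡.cong (λ k → q ^ ∣ U ∣ * noPairs k) (reversed-index i))) ⟩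
    Σᵣ.fold m₂ (λ i → q ^ ∣ U ∣ * noPairs (m₂ ∸ suc i))
      ≈⟨ Σᵣ-scale m₂ _ (λ i → noPairs (m₂ ∸ suc i)) ⟩
    q ^ ∣ U ∣ * Σᵣ.fold m₂ (λ i → noPairs (m₂ ∸ suc i))
      ≈⟨ *-cong refl (Σᵣ.fold-reverse m₂ noPairs) ⟩
    q ^ ∣ U ∣ * Σᵣ.fold m₂ noPairs ∎
    where
      -- (T + 1 - Y) - (i + 1) = T - (Y + i)
      reversed-index : ∀ i → 2 *ℕ n ∸ 2 *ℕ u ∸ (n +ℕ ℓ +ℕ i) ≡ m₂ ∸ suc i
      reversed-index i = ≡.sym (≡.trans (NP.∸-+-assoc (suc (2 *ℕ n ∸ 2 *ℕ u)) (n +ℕ ℓ) (suc i))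
                                        (≡.cong (suc (2 *ℕ n ∸ 2 *ℕ u) ∸_) (NP.+-suc (n +ℕ ℓ) i)))

  uncovered-bound : 1# - probCovered F p n ℓ u L U
                    ≤ᶠ q ^ ∣ L ∣ * Σᵣ.fold m₁ noPairs + q ^ ∣ U ∣ * Σᵣ.fold m₂ noPairs
  uncovered-bound = begin
    1# - probCovered F p n ℓ u L U
      ≈⟨ +-cong refl (-‿cong probCovered≈Exp) ⟩
    1# - Exp (λ R → indicator (coveredEvent n ℓ u (A R)))
      ≈⟨ E-complement n ω ω-normalised _ ⟨
    Exp (λ R → 1# - indicator (all (inSumsetShift (A R)) (lower ++ upper)))
      ≤⟨ E-mono n ω ω-nonneg (λ R → union-bound (inSumsetShift (A R)) (lower ++ upper)) ⟩
    Exp (λ R → Σ-list (lower ++ upper) (λ s → missing s R))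
      ≈⟨ E-Σ-list n ω ω-normalised (lower ++ upper) missing ⟩
    Σ-list (lower ++ upper) (λ s → Exp (missing s))
      ≈⟨ Σ-list-++ lower upper _ ⟩
    Σ-list lower (λ s → Exp (missing s)) + Σ-list upper (λ s → Exp (missing s))
      ≡⟨ ≡.cong₂ _+_ (Σ-list-interval (2 *ℕ ℓ) N _) (Σ-list-interval (n +ℕ ℓ) (2 *ℕ n ∸ 2 *ℕ u) _) ⟩
    Σᵣ.fold m₁ (λ i → Exp (missing (2 *ℕ ℓ +ℕ i))) + Σᵣ.fold m₂ (λ i → Exp (missing (n +ℕ ℓ +ℕ i)))
      ≤⟨ +-mono-≤ lower-sum upper-sum ⟩
    q ^ ∣ L ∣ * Σᵣ.fold m₁ noPairs + q ^ ∣ U ∣ * Σᵣ.fold m₂ noPairs ∎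
    where
      lower upper : List ℕ
      lower = interval (2 *ℕ ℓ) N
      upper = interval (n +ℕ ℓ) (2 *ℕ n ∸ 2 *ℕ u)

proposition2p4 : ∀ {c ℓ₁ ℓ₂ : Level} (F : OrderedField c ℓ₁ ℓ₂) →
    let open OrderedField F in
    (n ℓ u : ℕ) → ℓ +ℕ u ≤ n →
    (p : Carrier) → 0# < p → p < 1# →
    (L U : Subset n) →
    (∀ i → i ∈ L → toℕ i <ℕ ℓ) →
    (∀ i → i ∈ U → n ∸ u ≤ toℕ i) →
    let q = 1# - p in
    (1# - ((1# + q) * ((p ^ 2) ⁻¹)) * ((q ^ ∣ L ∣) + (q ^ ∣ U ∣)))
    < probCovered F p n ℓ u L U
proposition2p4 F n ℓ u ℓ+u≤n p 0<p p<1 L U L-low U-high = 1-‿swap-< (begin-strict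
  1# - probCovered F p n ℓ u L U
    ≤⟨ uncovered-bound ⟩
  q ^ ∣ L ∣ * Σᵣ.fold m₁ noPairs + q ^ ∣ U ∣ * Σᵣ.fold m₂ noPairs
    <⟨ +-mono-< (*-monoˡ-< (^-pos 0<q ∣ L ∣) (noPairs-sum< m₁))
                (*-monoˡ-< (^-pos 0<q ∣ U ∣) (noPairs-sum< m₂)) ⟩
  q ^ ∣ L ∣ * D + q ^ ∣ U ∣ * D
    ≈⟨ distribʳ D _ _ ⟨
  (q ^ ∣ L ∣ + q ^ ∣ U ∣) * D
    ≈⟨ *-comm _ D ⟩
  D * (q ^ ∣ L ∣ + q ^ ∣ U ∣) ∎)
  where
    open OrderedFieldProperties F
    open ≤-Reasoning
    open FiniteSums F using (module Σᵣ)
    open PairSeries F p 0<p p<1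
    open Model F n ℓ u ℓ+u≤n p 0<p p<1 L U L-low U-high using (uncovered-bound; m₁; m₂)
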